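{- Let $r,s$ be positive integers and $f$ an $(r,s)$-even function. Then $$\sum_{n=1}^{r^s}|\hat{f}(n)|^2=r^s\sum_{d\mid r}|f(d^s)|^2\,J_s\!\left(\frac{r^s}{d^s}\right).$$
   Context: For a positive integer $s$ and integers $a,b$ not both zero, $(a,b)_s$ denotes the largest $l^s$ ($l\in\mathbb{N}$) dividing both $a$ and $b$. An arithmetic function $f$ is $(r,s)$-even if $f(n)=f((n,r^s)_s)$ for all $n\in\mathbb{N}$; such $f$ is periodic mod $r^s$. Its discrete Fourier transform is $\hat f(n)=\sum_{k=1}^{r^s} f(k)\exp\left(-\frac{2\pi i k n}{r^s}\right)$. Here $J_s(N)$ denotes the number of integers $k$ with $1\le k\le N$ and $(k,N)_s=1$. -}

module Defs where

open import Level using (0ℓ)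
open import Data.Nat as ℕ using (ℕ; zero; suc; _^_; _/_)
open import Data.Nat.Divisibility using (_∣?_)
open import Data.List using (List; map; upTo; filter; length; foldr)
open import Data.Bool using (if_then_else_)
open import Relation.Nullary.Decidable using (_×-dec_; does)
open import Algebra.Bundles using (CommutativeRing)

range1 : ℕ → List ℕ
range1 N = map suc (upTo N)

-- (a , b)_s : the largest l^s (l ∈ ℕ, l ≥ 1) dividing both a and b.
-- Searches l = b, b-1, ..., 1; correct whenever s ≥ 1 and b ≥ 1
-- (then any l with l^s ∣ b satisfies l ≤ l^s ≤ b).
gcdₛ : ℕ → ℕ → ℕ → ℕ
gcdₛ s a b = go b
  where
  go : ℕ → ℕ
  go zero = 1
  go (suc l) = if does (((suc l) ^ s ∣? a) ×-dec ((suc l) ^ s ∣? b))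
               then (suc l) ^ s else go l

Jₛ : ℕ → ℕ → ℕ
Jₛ s N = length (filter (λ k → gcdₛ s k N ℕ.≟ 1) (range1 N))

divisors : ℕ → List ℕ
divisors r = filter (λ d → d ∣? r) (range1 r)

quot : ℕ → ℕ → ℕ
quot m zero = 0
quot m (suc n) = m / suc n

-- A commutative ring with a conjugation (ring involution-like map);
-- ℂ with complex conjugation is the intended instance.
record StarCommRing : Set₁ where
  field
    cring : CommutativeRing 0ℓ 0ℓ
  open CommutativeRing cring public
  field
    conj      : Carrier → Carrier
    conj-cong : ∀ {x y} → x ≈ y → conj x ≈ conj y
    conj-+    : ∀ x y → conj (x + y) ≈ conj x + conj y
    conj-*    : ∀ x y → conj (x * y) ≈ conj x * conj y
    conj-1    : conj 1# ≈ 1#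

  ∣_∣² : Carrier → Carrier
  ∣ z ∣² = z * conj z

  _^ᴿ_ : Carrier → ℕ → Carrier
  x ^ᴿ zero = 1#
  x ^ᴿ suc n = x * (x ^ᴿ n)

  _×ᴿ_ : ℕ → Carrier → Carrier
  zero ×ᴿ x = 0#
  suc n ×ᴿ x = x + (n ×ᴿ x)

  ι : ℕ → Carrier
  ι n = n ×ᴿ 1#

  Σ[_]_ : List ℕ → (ℕ → Carrier) → Carrier
  Σ[ xs ] g = foldr (λ k acc → g k + acc) 0# xs

  -- ζ is a primitive N-th root of unity with conj ζ = ζ⁻¹
  -- (for ℂ: ζ = exp(-2πi/N) satisfies this)
  record IsUnitaryPrimitiveRoot (N : ℕ) (ζ : Carrier) : Set where
    field
      pow-N      : ζ ^ᴿ N ≈ 1#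
      unitary    : ζ * conj ζ ≈ 1#
      orthogonal : ∀ k → 1 ℕ.≤ k → k ℕ.< N →
                   Σ[ range1 N ] (λ n → ζ ^ᴿ (k ℕ.* n)) ≈ 0#

  dft : ℕ → Carrier → (ℕ → Carrier) → ℕ → Carrier
  dft N ζ f n = Σ[ range1 N ] (λ k → f k * ζ ^ᴿ (k ℕ.* n))

  IsEven : ℕ → ℕ → (ℕ → Carrier) → Set
  IsEven r s f = ∀ n → 1 ℕ.≤ n → f n ≈ f (gcdₛ s n (r ^ s))

{-# OPTIONS --safe #-}
-- Parseval's identity for the DFT reduces the left-hand side to r^s · Σ_k |f(k)|².
-- Since f is (r,s)-even, f(k) = f((k, r^s)_s), and (k, r^s)_s always equals d^s for
-- some divisor d of r, so the sum groups by d with weight #{k ≤ r^s : (k, r^s)_s = d^s}.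
-- Writing r = t d, the k counted are exactly k = d^s j with (j, t^s)_s = 1, because
-- (d^s j, d^s M)_s = d^s (j, M)_s; hence the weight is J_s(r^s / d^s).
module Submission where

open import Defs
open import Data.Nat using (ℕ; _≤_; _^_; NonZero; >-nonZero)

module Range1 where
  open import Data.Nat
  open import Data.Nat.Properties
  open import Data.Nat.Divisibility using (_∣_; ∣⇒≤; ∣m+n∣m⇒∣n; m∣m*n)
  open import Data.List
  open import Data.List.Properties
  open import Data.List.Membership.Propositional using (_∈_)
  open import Data.List.Membership.Propositional.Properties using (∈-map⁺; ∈-map⁻; ∈-upTo⁺; ∈-upTo⁻)
  open import Data.List.Relation.Unary.All as All using (All)
  import Data.List.Relation.Unary.All.Properties as AllP
  open import Data.List.Relation.Unary.Unique.Propositional using (Unique)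
  import Data.List.Relation.Unary.Unique.Propositional.Properties as Unique
  open import Data.Product using (_×_; _,_)
  open import Function using (id; _∘_)
  open import Data.Bool using (true; false)
  open import Relation.Nullary.Decidable using (does)
  open import Relation.Binary.PropositionalEquality hiding ([_])
  open import Relation.Unary using (Pred; Decidable)
  open import Relation.Nullary using (¬_)
  open import Level using (0ℓ)

  range1-suc : ∀ n → range1 (suc n) ≡ range1 n ++ [ suc n ]
  range1-suc n = trans (cong (map suc) (sym (applyUpTo-∷ʳ id n))) (map-++ suc (upTo n) [ n ])

  range1-+ : ∀ m n → range1 (m + n) ≡ range1 m ++ map (m +_) (range1 n)
  range1-+ m zero = trans (cong range1 (+-identityʳ m)) (sym (++-identityʳ (range1 m)))
  range1-+ m (suc n) = begin
    range1 (m + suc n)                                      ≡⟨ cong range1 (+-suc m n) ⟩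
    range1 (suc (m + n))                                    ≡⟨ range1-suc (m + n) ⟩
    range1 (m + n) ++ [ suc (m + n) ]                       ≡⟨ cong (_++ [ suc (m + n) ]) (range1-+ m n) ⟩
    (range1 m ++ map (m +_) (range1 n)) ++ [ suc (m + n) ]  ≡⟨ ++-assoc (range1 m) _ _ ⟩
    range1 m ++ (map (m +_) (range1 n) ++ [ suc (m + n) ])  ≡⟨ cong (λ k → range1 m ++ (map (m +_) (range1 n) ++ [ k ])) (+-suc m n) ⟨
    range1 m ++ (map (m +_) (range1 n) ++ [ m + suc n ])    ≡⟨ cong (range1 m ++_) (map-++ (m +_) (range1 n) [ suc n ]) ⟨
    range1 m ++ map (m +_) (range1 n ++ [ suc n ])          ≡⟨ cong (λ ks → range1 m ++ map (m +_) ks) (range1-suc n) ⟨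
    range1 m ++ map (m +_) (range1 (suc n))                 ∎
    where open ≡-Reasoning

  length-range1 : ∀ n → length (range1 n) ≡ n
  length-range1 n = trans (length-map suc (upTo n)) (length-upTo n)

  ∈-range1⁺ : ∀ {k n} → 1 ≤ k → k ≤ n → k ∈ range1 n
  ∈-range1⁺ {suc _} _ k≤n = ∈-map⁺ suc (∈-upTo⁺ k≤n)

  ∈-range1⁻ : ∀ {k n} → k ∈ range1 n → 1 ≤ k × k ≤ n
  ∈-range1⁻ k∈ with _ , i∈ , refl ← ∈-map⁻ suc k∈ = s≤s z≤n , ∈-upTo⁻ i∈

  All-range1 : ∀ {P : Pred ℕ 0ℓ} n → (∀ {k} → 1 ≤ k → k ≤ n → P k) → All P (range1 n)
  All-range1 n p = All.tabulate λ k∈ → let 1≤k , k≤n = ∈-range1⁻ k∈ in p 1≤k k≤n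

  range1-unique : ∀ n → Unique (range1 n)
  range1-unique n = Unique.map⁺ suc-injective (Unique.upTo⁺ n)

  length-filter-++ : ∀ {P : Pred ℕ 0ℓ} (P? : Decidable P) xs ys →
    length (filter P? (xs ++ ys)) ≡ length (filter P? xs) + length (filter P? ys)
  length-filter-++ P? xs ys = trans (cong length (filter-++ P? xs ys)) (length-++ (filter P? xs))

  length-filter-map : ∀ {P : Pred ℕ 0ℓ} (P? : Decidable P) (f : ℕ → ℕ) xs →
    length (filter P? (map f xs)) ≡ length (filter (P? ∘ f) xs)
  length-filter-map P? f [] = refl
  length-filter-map P? f (x ∷ xs) with does (P? (f x))
  ... | true  = cong suc (length-filter-map P? f xs)
  ... | false = length-filter-map P? f xs

  module _ {P : Pred ℕ 0ℓ} (P? : Decidable P) where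

    length-filter-range1-* : ∀ D .{{_ : NonZero D}} → (∀ {k} → P k → D ∣ k) → ∀ M →
      length (filter P? (range1 (D * M))) ≡ length (filter (P? ∘ (D *_)) (range1 M))
    length-filter-range1-* D P⇒D∣ zero = cong (length ∘ filter P? ∘ range1) (*-zeroʳ D)
    length-filter-range1-* D@(suc D-1) P⇒D∣ (suc M) = begin
      length (filter P? (range1 (D * suc M)))
        ≡⟨ cong (length ∘ filter P?) (trans (cong range1 D*[1+M]) (range1-+ (D * M) D)) ⟩
      length (filter P? (range1 (D * M) ++ map (D * M +_) (range1 D)))
        ≡⟨ length-filter-++ P? (range1 (D * M)) _ ⟩
      length (filter P? (range1 (D * M))) + length (filter P? (map (D * M +_) (range1 D)))
        ≡⟨ cong₂ _+_ (length-filter-range1-* D P⇒D∣ M) (trans last-block (length-filter-map P? (D *_) [ suc M ])) ⟩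
      length (filter (P? ∘ (D *_)) (range1 M)) + length (filter (P? ∘ (D *_)) [ suc M ])
        ≡⟨ length-filter-++ (P? ∘ (D *_)) (range1 M) [ suc M ] ⟨
      length (filter (P? ∘ (D *_)) (range1 M ++ [ suc M ]))
        ≡⟨ cong (length ∘ filter (P? ∘ (D *_))) (range1-suc M) ⟨
      length (filter (P? ∘ (D *_)) (range1 (suc M))) ∎
      where
      open ≡-Reasoning
      D*[1+M] : D * suc M ≡ D * M + D
      D*[1+M] = trans (*-suc D M) (+-comm D (D * M))
      strictly-inside : All (¬_ ∘ P) (map (D * M +_) (range1 D-1))
      strictly-inside = AllP.map⁺ (All-range1 D-1 λ 1≤i i≤D-1 p →
        <⇒≱ (s≤s i≤D-1) (∣⇒≤ {{>-nonZero 1≤i}} (∣m+n∣m⇒∣n (P⇒D∣ p) (m∣m*n M))))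
      last-block : length (filter P? (map (D * M +_) (range1 D))) ≡ length (filter P? [ D * suc M ])
      last-block = begin
        length (filter P? (map (D * M +_) (range1 D)))
          ≡⟨ cong (length ∘ filter P?) (trans (cong (map (D * M +_)) (range1-suc D-1)) (map-++ (D * M +_) (range1 D-1) [ D ])) ⟩
        length (filter P? (map (D * M +_) (range1 D-1) ++ [ D * M + D ]))
          ≡⟨ length-filter-++ P? (map (D * M +_) (range1 D-1)) _ ⟩
        length (filter P? (map (D * M +_) (range1 D-1))) + length (filter P? [ D * M + D ])
          ≡⟨ cong₂ _+_ (cong length (filter-none P? strictly-inside)) (cong (λ k → length (filter P? [ k ])) (sym D*[1+M])) ⟩
        length (filter P? [ D * suc M ]) ∎

module PowerGcd where
  open import Data.Nat
  open import Data.Nat.Properties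
  open import Data.Nat.Divisibility
  open import Data.Nat.DivMod using (m*[n/m]≡n; m*n/n≡m)
  open import Data.Nat.GCD using (gcd; gcd[m,n]∣m; gcd[m,n]∣n; gcd[m,n]≢0)
  open import Data.Nat.Coprimality as Coprime using (Coprime; coprime-divisor; coprime-/gcd)
  open import Data.Bool using (Bool; if_then_else_)
  open import Data.List using (map; filter; length)
  open import Data.List.Membership.Propositional using (_∈_)
  open import Data.List.Membership.Propositional.Properties using (∈-filter⁺; ∈-map⁺)
  open import Data.List.Relation.Unary.Unique.Propositional using (Unique)
  import Data.List.Relation.Unary.Unique.Propositional.Properties as Unique
  open import Data.List.Properties using (filter-≐)
  open import Data.Product using (∃-syntax; _×_; _,_; proj₁; proj₂)
  open import Data.Sum using (inj₁; inj₂)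
  open import Relation.Nullary using (¬_; yes; no; contradiction)
  open import Function using (_∘_)
  open import Relation.Nullary.Decidable using (_×-dec_; does)
  open import Relation.Binary.PropositionalEquality
  open import Relation.Binary.Definitions using (tri<; tri≈; tri>)
  open Range1

  ^-distribʳ-* : ∀ m n k → (m * n) ^ k ≡ m ^ k * n ^ k
  ^-distribʳ-* m n zero    = refl
  ^-distribʳ-* m n (suc k) = begin
    (m * n) * (m * n) ^ k     ≡⟨ cong ((m * n) *_) (^-distribʳ-* m n k) ⟩
    (m * n) * (m ^ k * n ^ k) ≡⟨ [m*n]*[o*p]≡[m*o]*[n*p] m n (m ^ k) (n ^ k) ⟩
    m ^ suc k * n ^ suc k     ∎
    where open ≡-Reasoning

  ^-injectiveˡ : ∀ k .{{_ : NonZero k}} {m n} → m ^ k ≡ n ^ k → m ≡ n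
  ^-injectiveˡ k {m} {n} eq with <-cmp m n
  ... | tri< m<n _ _ = contradiction eq (<⇒≢ (^-monoˡ-< k m<n))
  ... | tri≈ _ m≡n _ = m≡n
  ... | tri> _ _ n<m = contradiction (sym eq) (<⇒≢ (^-monoˡ-< k n<m))

  m≤m^n : ∀ m n .{{_ : NonZero m}} .{{_ : NonZero n}} → m ≤ m ^ n
  m≤m^n m n@(suc _) = subst (_≤ m ^ n) (*-identityʳ m) (^-monoʳ-≤ m {1} {n} (s≤s z≤n))

  m^n∣o⇒m≤o : ∀ {m o} n .{{_ : NonZero m}} .{{_ : NonZero n}} .{{_ : NonZero o}} → m ^ n ∣ o → m ≤ o
  m^n∣o⇒m≤o {m} n m^n∣o = ≤-trans (m≤m^n m n) (∣⇒≤ m^n∣o)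

  coprime-*ʳ : ∀ {m n o} → Coprime m n → Coprime m o → Coprime m (n * o)
  coprime-*ʳ {n = n} m⊥n m⊥o {c} (c∣m , c∣n*o) = m⊥o (c∣m , coprime-divisor c⊥n c∣n*o)
    where
    c⊥n : Coprime c n
    c⊥n (e∣c , e∣n) = m⊥n (∣-trans e∣c c∣m , e∣n)

  coprime-^ʳ : ∀ {m n} k → Coprime m n → Coprime m (n ^ k)
  coprime-^ʳ zero    m⊥n (_ , c∣1) = ∣1⇒≡1 c∣1
  coprime-^ʳ (suc k) m⊥n = coprime-*ʳ m⊥n (coprime-^ʳ k m⊥n)

  coprime-^ : ∀ {m n} k → Coprime m n → Coprime (m ^ k) (n ^ k)
  coprime-^ k m⊥n = coprime-^ʳ k (Coprime.sym (coprime-^ʳ k (Coprime.sym m⊥n)))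

  record GcdSplit (m n : ℕ) : Set where
    field
      g m′ n′     : ℕ
      {{g≢0}}     : NonZero g
      m≡g*m′      : m ≡ g * m′
      n≡g*n′      : n ≡ g * n′
      coprime     : Coprime m′ n′

  gcdSplit : ∀ m n .{{_ : NonZero n}} → GcdSplit m n
  gcdSplit m n = record
    { m≡g*m′ = sym (m*[n/m]≡n (gcd[m,n]∣m m n))
    ; n≡g*n′ = sym (m*[n/m]≡n (gcd[m,n]∣n m n))
    ; coprime = coprime-/gcd m n
    }
    where
    instance
      gcd≢0 : NonZero (gcd m n)
      gcd≢0 = ≢-nonZero (gcd[m,n]≢0 m n (inj₂ (≢-nonZero⁻¹ n)))

  module _ {m n} .{{_ : NonZero n}} (split : GcdSplit m n) where
    open GcdSplit split

    split-^∣ : ∀ k x → m ^ k ∣ n ^ k * x → m′ ^ k ∣ x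
    split-^∣ k x m^k∣n^k*x = coprime-divisor (coprime-^ k coprime) (*-cancelˡ-∣ (g ^ k) {{m^n≢0 g k}} g^k*m′^k∣g^k*[n′^k*x])
      where
      g^k*m′^k∣g^k*[n′^k*x] : g ^ k * m′ ^ k ∣ g ^ k * (n′ ^ k * x)
      g^k*m′^k∣g^k*[n′^k*x] = subst₂ _∣_
        (trans (cong (_^ k) m≡g*m′) (^-distribʳ-* g m′ k))
        (trans (cong (λ y → y ^ k * x) n≡g*n′) (trans (cong (_* x) (^-distribʳ-* g n′ k)) (*-assoc (g ^ k) (n′ ^ k) x)))
        m^k∣n^k*x

    split-^∣^ : ∀ k .{{_ : NonZero k}} → m ^ k ∣ n ^ k → m ∣ n
    split-^∣^ k@(suc k-1) m^k∣n^k = subst₂ _∣_ (sym m≡g) (sym n≡g*n′) (m∣m*n n′)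
      where
      m′≡1 : m′ ≡ 1
      m′≡1 = ∣1⇒≡1 (∣-trans (m∣m*n (m′ ^ k-1)) (split-^∣ k 1 (subst (m ^ k ∣_) (sym (*-identityʳ (n ^ k))) m^k∣n^k)))
      m≡g : m ≡ g
      m≡g = trans m≡g*m′ (trans (cong (g *_) m′≡1) (*-identityʳ g))

    split-≤ : ∀ {h} → m′ ≤ h → m ≤ n * h
    split-≤ {h} m′≤h = begin
      m      ≡⟨ m≡g*m′ ⟩
      g * m′ ≤⟨ *-mono-≤ g≤n m′≤h ⟩
      n * h  ∎
      where
      open ≤-Reasoning
      g≤n : g ≤ n
      g≤n = ∣⇒≤ (subst (g ∣_) (sym n≡g*n′) (m∣m*n n′))

  searchₛ : ℕ → ℕ → ℕ → ℕ → ℕ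
  searchₛ s a b zero    = 1
  searchₛ s a b (suc l) = if does ((suc l ^ s ∣? a) ×-dec (suc l ^ s ∣? b)) then suc l ^ s else searchₛ s a b l

  -- The search loop of gcdₛ is local to its definition. The meta go is solved by unifying
  -- with that loop; the with-abstractions in unfold make its arguments distinct variables,
  -- so that this unification problem is a pattern.
  gcdₛ≡searchₛ : ∀ s a b → gcdₛ s a b ≡ searchₛ s a b b
  gcdₛ≡searchₛ s a zero    = refl
  gcdₛ≡searchₛ s a (suc b) = trans (unfold b) (cong (if test then suc b ^ s else_) (loop (suc b) b))
    where
    test : Bool
    test = does ((suc b ^ s ∣? a) ×-dec (suc b ^ s ∣? suc b))
    go : ℕ → ℕ → ℕ
    go = _
    unfold : ∀ n → gcdₛ s a (suc n) ≡ (if does ((suc n ^ s ∣? a) ×-dec (suc n ^ s ∣? suc n)) then suc n ^ s else go (suc n) n)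
    unfold n with suc n
    ... | B with n
    ... | l = refl
    loop : ∀ B l → go B l ≡ searchₛ s a B l
    loop B zero    = refl
    loop B (suc l) = cong (if does ((suc l ^ s ∣? a) ×-dec (suc l ^ s ∣? B)) then suc l ^ s else_) (loop B l)

  record IsGcdₛRoot (s a b bound h : ℕ) : Set where
    field
      {{h≢0}}     : NonZero h
      h^s∣a       : h ^ s ∣ a
      h^s∣b       : h ^ s ∣ b
      largest     : ∀ {l} .{{_ : NonZero l}} → l ≤ bound → l ^ s ∣ a → l ^ s ∣ b → l ≤ h

  IsGcdₛRoot-suc : ∀ {s a b l h} → IsGcdₛRoot s a b l h → ¬ (suc l ^ s ∣ a × suc l ^ s ∣ b) →
                   IsGcdₛRoot s a b (suc l) h
  IsGcdₛRoot-suc {s} {a} {b} {l} {h} root ¬1+l^s∣a×b = record { h^s∣a = h^s∣a ; h^s∣b = h^s∣b ; largest = largest }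
    where
    open IsGcdₛRoot root renaming (largest to largest-upto-l)
    largest : ∀ {m} .{{_ : NonZero m}} → m ≤ suc l → m ^ s ∣ a → m ^ s ∣ b → m ≤ h
    largest m≤1+l m^s∣a m^s∣b with m≤n⇒m<n∨m≡n m≤1+l
    ... | inj₁ m≤l  = largest-upto-l (≤-pred m≤l) m^s∣a m^s∣b
    ... | inj₂ refl = contradiction (m^s∣a , m^s∣b) ¬1+l^s∣a×b

  searchₛ-root : ∀ s a b l → ∃[ h ] searchₛ s a b l ≡ h ^ s × IsGcdₛRoot s a b l h
  searchₛ-root s a b zero = 1 , sym (^-zeroˡ s) , record
    { h^s∣a   = subst (_∣ a) (sym (^-zeroˡ s)) (1∣ a)
    ; h^s∣b   = subst (_∣ b) (sym (^-zeroˡ s)) (1∣ b)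
    ; largest = λ {l} l≤0 _ _ → contradiction (n≤0⇒n≡0 l≤0) (≢-nonZero⁻¹ l)
    }
  searchₛ-root s a b (suc l) with suc l ^ s ∣? a | suc l ^ s ∣? b | searchₛ-root s a b l
  ... | yes 1+l^s∣a | yes 1+l^s∣b | _ =
    suc l , refl , record { h^s∣a = 1+l^s∣a ; h^s∣b = 1+l^s∣b ; largest = λ m≤1+l _ _ → m≤1+l }
  ... | no ¬1+l^s∣a | _ | h , eq , root = h , eq , IsGcdₛRoot-suc root (¬1+l^s∣a ∘ proj₁)
  ... | yes _ | no ¬1+l^s∣b | h , eq , root = h , eq , IsGcdₛRoot-suc root (¬1+l^s∣b ∘ proj₂)

  gcdₛ-root : ∀ s a b → ∃[ h ] gcdₛ s a b ≡ h ^ s × IsGcdₛRoot s a b b h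
  gcdₛ-root s a b with h , eq , root ← searchₛ-root s a b b = h , trans (gcdₛ≡searchₛ s a b) eq , root

  gcdₛ∣ˡ : ∀ s a b → gcdₛ s a b ∣ a
  gcdₛ∣ˡ s a b with h , eq , root ← gcdₛ-root s a b = subst (_∣ a) (sym eq) (IsGcdₛRoot.h^s∣a root)

  IsGcdₛRoot-unique : ∀ {s a b h h′} .{{_ : NonZero s}} .{{_ : NonZero b}} →
                      IsGcdₛRoot s a b b h → IsGcdₛRoot s a b b h′ → h ≡ h′
  IsGcdₛRoot-unique {s} root root′ = ≤-antisym (below root root′) (below root′ root)
    where
    below : ∀ {h h′} → IsGcdₛRoot _ _ _ _ h → IsGcdₛRoot _ _ _ _ h′ → h ≤ h′
    below root root′ = IsGcdₛRoot.largest root′ (m^n∣o⇒m≤o s h^s∣b) h^s∣a h^s∣b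
      where open IsGcdₛRoot root

  IsGcdₛRoot-*ˡ : ∀ {s j M h} d .{{_ : NonZero s}} .{{_ : NonZero d}} .{{_ : NonZero M}} →
                  IsGcdₛRoot s j M M h → IsGcdₛRoot s (d ^ s * j) (d ^ s * M) (d ^ s * M) (d * h)
  IsGcdₛRoot-*ˡ {s} {j} {M} {h} d root = record
    { h≢0     = m*n≢0 d h
    ; h^s∣a   = [d*h]^s∣d^s* h^s∣a
    ; h^s∣b   = [d*h]^s∣d^s* h^s∣b
    ; largest = largest
    }
    where
    open IsGcdₛRoot root renaming (largest to largest-root)
    [d*h]^s∣d^s* : ∀ {x} → h ^ s ∣ x → (d * h) ^ s ∣ d ^ s * x
    [d*h]^s∣d^s* h^s∣x = subst (_∣ _) (sym (^-distribʳ-* d h s)) (*-monoʳ-∣ (d ^ s) h^s∣x)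
    largest : ∀ {l} .{{_ : NonZero l}} → l ≤ d ^ s * M → l ^ s ∣ d ^ s * j → l ^ s ∣ d ^ s * M → l ≤ d * h
    largest {l} _ l^s∣d^s*j l^s∣d^s*M = split-≤ split
      (largest-root {{l′≢0}} (m^n∣o⇒m≤o s {{l′≢0}} l′^s∣M) (split-^∣ split s j l^s∣d^s*j) l′^s∣M)
      where
      split : GcdSplit l d
      split = gcdSplit l d
      open GcdSplit split using (g; m≡g*m′) renaming (m′ to l′)
      l′^s∣M : l′ ^ s ∣ M
      l′^s∣M = split-^∣ split s M l^s∣d^s*M
      l′≢0 : NonZero l′
      l′≢0 = ≢-nonZero λ l′≡0 → ≢-nonZero⁻¹ l (trans m≡g*m′ (trans (cong (g *_) l′≡0) (*-zeroʳ g)))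

  gcdₛ-*ˡ : ∀ s d j M .{{_ : NonZero s}} .{{_ : NonZero d}} .{{_ : NonZero M}} →
            gcdₛ s (d ^ s * j) (d ^ s * M) ≡ d ^ s * gcdₛ s j M
  gcdₛ-*ˡ s d j M with h , eq , root ← gcdₛ-root s j M | h′ , eq′ , root′ ← gcdₛ-root s (d ^ s * j) (d ^ s * M) = begin
    gcdₛ s (d ^ s * j) (d ^ s * M) ≡⟨ eq′ ⟩
    h′ ^ s                         ≡⟨ cong (_^ s) (IsGcdₛRoot-unique root′ (IsGcdₛRoot-*ˡ d root)) ⟩
    (d * h) ^ s                    ≡⟨ ^-distribʳ-* d h s ⟩
    d ^ s * h ^ s                  ≡⟨ cong (d ^ s *_) eq ⟨
    d ^ s * gcdₛ s j M             ∎
    where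
    open ≡-Reasoning
    instance
      d^s*M≢0 : NonZero (d ^ s * M)
      d^s*M≢0 = m*n≢0 (d ^ s) M {{m^n≢0 d s}}

  count-gcdₛ≡ : ∀ s d M .{{_ : NonZero s}} .{{_ : NonZero d}} .{{_ : NonZero M}} →
    length (filter (λ k → gcdₛ s k (d ^ s * M) ≟ d ^ s) (range1 (d ^ s * M))) ≡ Jₛ s M
  count-gcdₛ≡ s d M = trans
    (length-filter-range1-* (λ k → gcdₛ s k (d ^ s * M) ≟ d ^ s) (d ^ s) {{m^n≢0 d s}} d^s∣ M)
    (cong length (filter-≐ _ _ (to , from) (range1 M)))
    where
    d^s∣ : ∀ {k} → gcdₛ s k (d ^ s * M) ≡ d ^ s → d ^ s ∣ k
    d^s∣ {k} eq = subst (_∣ k) eq (gcdₛ∣ˡ s k (d ^ s * M))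
    to : ∀ {j} → gcdₛ s (d ^ s * j) (d ^ s * M) ≡ d ^ s → gcdₛ s j M ≡ 1
    to {j} eq = *-cancelˡ-≡ _ 1 (d ^ s) {{m^n≢0 d s}} (trans (sym (gcdₛ-*ˡ s d j M)) (trans eq (sym (*-identityʳ (d ^ s)))))
    from : ∀ {j} → gcdₛ s j M ≡ 1 → gcdₛ s (d ^ s * j) (d ^ s * M) ≡ d ^ s
    from {j} eq = trans (gcdₛ-*ˡ s d j M) (trans (cong (d ^ s *_) eq) (*-identityʳ (d ^ s)))

  quot≡/ : ∀ m n .{{_ : NonZero n}} → quot m n ≡ m / n
  quot≡/ m (suc n) = refl

  count-gcdₛ≡-∣ : ∀ s r d .{{_ : NonZero s}} .{{_ : NonZero r}} → d ∣ r →
    length (filter (λ k → gcdₛ s k (r ^ s) ≟ d ^ s) (range1 (r ^ s))) ≡ Jₛ s (quot (r ^ s) (d ^ s))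
  count-gcdₛ≡-∣ s r d {{_}} {{r≢0}} (divides t refl) = begin
    length (filter (λ k → gcdₛ s k ((t * d) ^ s) ≟ d ^ s) (range1 ((t * d) ^ s)))
      ≡⟨ cong (λ n → length (filter (λ k → gcdₛ s k n ≟ d ^ s) (range1 n))) [t*d]^s≡d^s*t^s ⟩
    length (filter (λ k → gcdₛ s k (d ^ s * t ^ s) ≟ d ^ s) (range1 (d ^ s * t ^ s)))
      ≡⟨ count-gcdₛ≡ s d (t ^ s) ⟩
    Jₛ s (t ^ s)
      ≡⟨ cong (Jₛ s) (m*n/n≡m (t ^ s) (d ^ s)) ⟨
    Jₛ s (t ^ s * d ^ s / d ^ s)
      ≡⟨ cong (λ n → Jₛ s (n / d ^ s)) (^-distribʳ-* t d s) ⟨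
    Jₛ s ((t * d) ^ s / d ^ s)
      ≡⟨ cong (Jₛ s) (quot≡/ ((t * d) ^ s) (d ^ s)) ⟨
    Jₛ s (quot ((t * d) ^ s) (d ^ s)) ∎
    where
    open ≡-Reasoning
    instance
      t≢0 : NonZero t
      t≢0 = m*n≢0⇒m≢0 t {{r≢0}}
      d≢0 : NonZero d
      d≢0 = m*n≢0⇒n≢0 t {{r≢0}}
      t^s≢0 : NonZero (t ^ s)
      t^s≢0 = m^n≢0 t s {{t≢0}}
      d^s≢0 : NonZero (d ^ s)
      d^s≢0 = m^n≢0 d s {{d≢0}}
    [t*d]^s≡d^s*t^s : (t * d) ^ s ≡ d ^ s * t ^ s
    [t*d]^s≡d^s*t^s = trans (^-distribʳ-* t d s) (*-comm (t ^ s) (d ^ s))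

  ∈-divisors⁺ : ∀ {d r} .{{_ : NonZero r}} → d ∣ r → d ∈ divisors r
  ∈-divisors⁺ {d} {r} d∣r = ∈-filter⁺ (_∣? r) (∈-range1⁺ 1≤d (∣⇒≤ d∣r)) d∣r
    where
    1≤d : 1 ≤ d
    1≤d = n≢0⇒n>0 λ d≡0 → ≢-nonZero⁻¹ r (0∣⇒≡0 (subst (_∣ r) d≡0 d∣r))

  divisors-unique : ∀ r → Unique (divisors r)
  divisors-unique r = Unique.filter⁺ (_∣? r) (range1-unique r)

  gcdₛ-^ʳ∈ : ∀ s k r .{{_ : NonZero s}} .{{_ : NonZero r}} → gcdₛ s k (r ^ s) ∈ map (_^ s) (divisors r)
  gcdₛ-^ʳ∈ s k r with h , eq , root ← gcdₛ-root s k (r ^ s) =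
    subst (_∈ _) (sym eq) (∈-map⁺ (_^ s) (∈-divisors⁺ (split-^∣^ (gcdSplit h r) s (IsGcdₛRoot.h^s∣b root))))

  divisor-powers-unique : ∀ s r .{{_ : NonZero s}} → Unique (map (_^ s) (divisors r))
  divisor-powers-unique s r = Unique.map⁺ (^-injectiveˡ s) (divisors-unique r)

module StarCommRingProperties (R : StarCommRing) where
  open StarCommRing R
  open import Data.Nat as ℕ using (zero; suc; _≟_)
  open import Data.Nat.Divisibility using (_∣?_)
  open import Data.Nat.Properties as ℕ using ()
  open import Data.Bool using (Bool; true; false; if_then_else_)
  open import Data.List using (List; []; _∷_; map; filter; length)
  open import Data.List.Membership.Propositional using (_∈_)
  open import Data.List.Relation.Unary.All as All using (All; []; _∷_)
  open import Data.List.Relation.Unary.Any using (here; there)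
  open import Data.List.Relation.Unary.Unique.Propositional using (Unique)
  open import Data.List.Relation.Unary.AllPairs using (_∷_)
  open import Relation.Nullary.Decidable using (does; dec-true; dec-false)
  open import Relation.Unary using (Pred; Decidable)
  open import Level using (0ℓ)
  open import Relation.Binary.Definitions using (tri<; tri≈; tri>)
  import Relation.Binary.PropositionalEquality as P
  open import Relation.Binary.Reasoning.Setoid setoid
  import Algebra.Properties.CommutativeSemigroup as CommSemigroupProperties
  module +-Properties = CommSemigroupProperties +-commutativeSemigroup
  module *-Properties = CommSemigroupProperties *-commutativeSemigroup
  open import Algebra.Properties.Group +-group using () renaming (∙-cancelˡ to +-cancelˡ)
  open Range1 using (length-range1; All-range1; ∈-range1⁺; range1-unique)
  open PowerGcd using (gcdₛ-^ʳ∈; divisor-powers-unique; count-gcdₛ≡-∣)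
  open import Data.List.Relation.Unary.All.Properties using (all-filter)

  Σ-cong : ∀ xs {f g : ℕ → Carrier} → (∀ x → f x ≈ g x) → Σ[ xs ] f ≈ Σ[ xs ] g
  Σ-cong []       f≈g = refl
  Σ-cong (x ∷ xs) f≈g = +-cong (f≈g x) (Σ-cong xs f≈g)

  Σ-congᴬ : ∀ {xs} {f g : ℕ → Carrier} → All (λ x → f x ≈ g x) xs → Σ[ xs ] f ≈ Σ[ xs ] g
  Σ-congᴬ []           = refl
  Σ-congᴬ (fx≈gx ∷ ps) = +-cong fx≈gx (Σ-congᴬ ps)

  Σ-zero : ∀ {xs} {f : ℕ → Carrier} → All (λ x → f x ≈ 0#) xs → Σ[ xs ] f ≈ 0#
  Σ-zero []           = refl
  Σ-zero (fx≈0 ∷ ps) = trans (+-cong fx≈0 (Σ-zero ps)) (+-identityˡ 0#)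

  Σ-map : ∀ (h : ℕ → ℕ) xs {f : ℕ → Carrier} → Σ[ map h xs ] f ≈ Σ[ xs ] (λ x → f (h x))
  Σ-map h []       = refl
  Σ-map h (x ∷ xs) = +-cong refl (Σ-map h xs)

  Σ-+ : ∀ xs {f g : ℕ → Carrier} → Σ[ xs ] (λ x → f x + g x) ≈ Σ[ xs ] f + Σ[ xs ] g
  Σ-+ []               = sym (+-identityˡ 0#)
  Σ-+ (x ∷ xs) {f} {g} = trans (+-cong refl (Σ-+ xs)) (+-Properties.interchange (f x) (g x) _ _)

  Σ-*ˡ : ∀ xs c {f : ℕ → Carrier} → c * Σ[ xs ] f ≈ Σ[ xs ] (λ x → c * f x)
  Σ-*ˡ []       c = zeroʳ c
  Σ-*ˡ (x ∷ xs) c = trans (distribˡ c _ _) (+-cong refl (Σ-*ˡ xs c))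

  Σ-*ʳ : ∀ xs c {f : ℕ → Carrier} → Σ[ xs ] f * c ≈ Σ[ xs ] (λ x → f x * c)
  Σ-*ʳ []       c = zeroˡ c
  Σ-*ʳ (x ∷ xs) c = trans (distribʳ c _ _) (+-cong refl (Σ-*ʳ xs c))

  Σ-swap : ∀ xs ys {f : ℕ → ℕ → Carrier} →
           Σ[ xs ] (λ x → Σ[ ys ] (f x)) ≈ Σ[ ys ] (λ y → Σ[ xs ] (λ x → f x y))
  Σ-swap []       ys = sym (Σ-zero {ys} (All.tabulate λ _ → refl))
  Σ-swap (x ∷ xs) ys = trans (+-cong refl (Σ-swap xs ys)) (sym (Σ-+ ys))

  conj-0 : conj 0# ≈ 0#
  conj-0 = +-cancelˡ (conj 0#) (conj 0#) 0#
    (trans (sym (conj-+ 0# 0#)) (trans (conj-cong (+-identityˡ 0#)) (sym (+-identityʳ (conj 0#)))))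

  conj-Σ : ∀ xs {f : ℕ → Carrier} → conj (Σ[ xs ] f) ≈ Σ[ xs ] (λ x → conj (f x))
  conj-Σ []       = conj-0
  conj-Σ (x ∷ xs) = trans (conj-+ _ _) (+-cong refl (conj-Σ xs))

  conj-^ : ∀ x n → conj (x ^ᴿ n) ≈ conj x ^ᴿ n
  conj-^ x zero    = conj-1
  conj-^ x (suc n) = trans (conj-* x (x ^ᴿ n)) (*-cong refl (conj-^ x n))

  ^-+ : ∀ x m n → x ^ᴿ (m ℕ.+ n) ≈ x ^ᴿ m * x ^ᴿ n
  ^-+ x zero    n = sym (*-identityˡ _)
  ^-+ x (suc m) n = trans (*-cong refl (^-+ x m n)) (sym (*-assoc x _ _))

  ^-*-inverse : ∀ {x y} → x * y ≈ 1# → ∀ n → x ^ᴿ n * y ^ᴿ n ≈ 1#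
  ^-*-inverse x*y≈1 zero    = *-identityˡ 1#
  ^-*-inverse {x} {y} x*y≈1 (suc n) = begin
    (x * x ^ᴿ n) * (y * y ^ᴿ n) ≈⟨ *-Properties.interchange x (x ^ᴿ n) y (y ^ᴿ n) ⟩
    (x * y) * (x ^ᴿ n * y ^ᴿ n) ≈⟨ *-cong x*y≈1 (^-*-inverse x*y≈1 n) ⟩
    1# * 1#                     ≈⟨ *-identityˡ 1# ⟩
    1#                          ∎

  ^-+-cancelʳ : ∀ {x y} → x * y ≈ 1# → ∀ m n → x ^ᴿ (m ℕ.+ n) * y ^ᴿ n ≈ x ^ᴿ m
  ^-+-cancelʳ {x} {y} x*y≈1 m n = begin
    x ^ᴿ (m ℕ.+ n) * y ^ᴿ n     ≈⟨ *-cong (^-+ x m n) refl ⟩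
    (x ^ᴿ m * x ^ᴿ n) * y ^ᴿ n  ≈⟨ *-assoc _ _ _ ⟩
    x ^ᴿ m * (x ^ᴿ n * y ^ᴿ n)  ≈⟨ *-cong refl (^-*-inverse x*y≈1 n) ⟩
    x ^ᴿ m * 1#                 ≈⟨ *-identityʳ _ ⟩
    x ^ᴿ m                      ∎

  ×ᴿ≈*ι : ∀ n x → n ×ᴿ x ≈ x * ι n
  ×ᴿ≈*ι zero    x = sym (zeroʳ x)
  ×ᴿ≈*ι (suc n) x = begin
    x + n ×ᴿ x         ≈⟨ +-cong (sym (*-identityʳ x)) (×ᴿ≈*ι n x) ⟩
    x * 1# + x * ι n   ≈⟨ distribˡ x 1# (ι n) ⟨
    x * (1# + ι n)     ∎

  ×ᴿ-congˡ : ∀ n {x y} → x ≈ y → n ×ᴿ x ≈ n ×ᴿ y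
  ×ᴿ-congˡ zero    x≈y = refl
  ×ᴿ-congˡ (suc n) x≈y = +-cong x≈y (×ᴿ-congˡ n x≈y)

  ⟦_⟧ : Bool → Carrier
  ⟦ b ⟧ = if b then 1# else 0#

  ⟦≟⟧-refl : ∀ k → ⟦ does (k ≟ k) ⟧ ≈ 1#
  ⟦≟⟧-refl k = reflexive (P.cong ⟦_⟧ (dec-true (k ≟ k) P.refl))

  ⟦≟⟧-≢ : ∀ {k l} → k P.≢ l → ⟦ does (k ≟ l) ⟧ ≈ 0#
  ⟦≟⟧-≢ {k} {l} k≢l = reflexive (P.cong ⟦_⟧ (dec-false (k ≟ l) k≢l))

  Σ-δ : ∀ {xs} → Unique xs → ∀ {k} → k ∈ xs → (F : ℕ → Carrier) → Σ[ xs ] (λ l → ⟦ does (k ≟ l) ⟧ * F l) ≈ F k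
  Σ-δ {k ∷ _} (k∉xs ∷ _) (here P.refl) F = trans (+-cong ⟦k≟k⟧*Fk≈Fk (Σ-zero (All.map ⟦k≟l⟧*Fl≈0 k∉xs))) (+-identityʳ _)
    where
    ⟦k≟k⟧*Fk≈Fk : ⟦ does (k ≟ k) ⟧ * F k ≈ F k
    ⟦k≟k⟧*Fk≈Fk = trans (*-cong (⟦≟⟧-refl k) refl) (*-identityˡ (F k))
    ⟦k≟l⟧*Fl≈0 : ∀ {l} → k P.≢ l → ⟦ does (k ≟ l) ⟧ * F l ≈ 0#
    ⟦k≟l⟧*Fl≈0 k≢l = trans (*-cong (⟦≟⟧-≢ k≢l) refl) (zeroˡ _)
  Σ-δ {x ∷ _} (x∉xs ∷ xs-unique) {k} (there k∈xs) F =
    trans (+-cong ⟦k≟x⟧*Fx≈0 (Σ-δ xs-unique k∈xs F)) (+-identityˡ _)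
    where
    ⟦k≟x⟧*Fx≈0 : ⟦ does (k ≟ x) ⟧ * F x ≈ 0#
    ⟦k≟x⟧*Fx≈0 = trans (*-cong (⟦≟⟧-≢ λ k≡x → All.lookup x∉xs k∈xs (P.sym k≡x)) refl) (zeroˡ (F x))

  ι-length-filter : ∀ {P : Pred ℕ 0ℓ} (P? : Decidable P) xs → ι (length (filter P? xs)) ≈ Σ[ xs ] (λ x → ⟦ does (P? x) ⟧)
  ι-length-filter P? []       = refl
  ι-length-filter P? (x ∷ xs) with does (P? x)
  ... | true  = +-cong refl (ι-length-filter P? xs)
  ... | false = trans (ι-length-filter P? xs) (sym (+-identityˡ _))

  Σ-by-value : ∀ (G : ℕ → ℕ) (h : ℕ → Carrier) {vs} → Unique vs → ∀ xs → All (λ x → G x ∈ vs) xs →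
               Σ[ xs ] (λ x → h (G x)) ≈ Σ[ vs ] (λ v → h v * ι (length (filter (λ x → G x ≟ v) xs)))
  Σ-by-value G h {vs} vs-unique xs G[xs]⊆vs = begin
    Σ[ xs ] (λ x → h (G x))
      ≈⟨ Σ-congᴬ (All.map (λ Gx∈vs → sym (Σ-δ vs-unique Gx∈vs h)) G[xs]⊆vs) ⟩
    Σ[ xs ] (λ x → Σ[ vs ] (λ v → ⟦ does (G x ≟ v) ⟧ * h v))
      ≈⟨ Σ-swap xs vs ⟩
    Σ[ vs ] (λ v → Σ[ xs ] (λ x → ⟦ does (G x ≟ v) ⟧ * h v))
      ≈⟨ Σ-cong vs (λ v → sym (Σ-*ʳ xs (h v))) ⟩
    Σ[ vs ] (λ v → Σ[ xs ] (λ x → ⟦ does (G x ≟ v) ⟧) * h v)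
      ≈⟨ Σ-cong vs (λ v → trans (*-comm _ (h v)) (*-cong refl (sym (ι-length-filter (λ x → G x ≟ v) xs)))) ⟩
    Σ[ vs ] (λ v → h v * ι (length (filter (λ x → G x ≟ v) xs))) ∎

  Σ-1 : ∀ xs → Σ[ xs ] (λ _ → 1#) ≈ ι (length xs)
  Σ-1 []       = refl
  Σ-1 (x ∷ xs) = +-cong refl (Σ-1 xs)

  module _ {N ζ} (ζ-root : IsUnitaryPrimitiveRoot N ζ) where
    open IsUnitaryPrimitiveRoot ζ-root

    private
      e : ℕ → ℕ → ℕ → Carrier
      e k l n = ζ ^ᴿ (k ℕ.* n) * conj ζ ^ᴿ (l ℕ.* n)

      e-+ˡ : ∀ m l n → e (m ℕ.+ l) l n ≈ ζ ^ᴿ (m ℕ.* n)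
      e-+ˡ m l n = trans (*-cong (reflexive (P.cong (ζ ^ᴿ_) (ℕ.*-distribʳ-+ n m l))) refl)
                         (^-+-cancelʳ unitary (m ℕ.* n) (l ℕ.* n))

      e-+ʳ : ∀ m k n → e k (m ℕ.+ k) n ≈ conj (ζ ^ᴿ (m ℕ.* n))
      e-+ʳ m k n = begin
        ζ ^ᴿ (k ℕ.* n) * conj ζ ^ᴿ ((m ℕ.+ k) ℕ.* n)     ≈⟨ *-comm _ _ ⟩
        conj ζ ^ᴿ ((m ℕ.+ k) ℕ.* n) * ζ ^ᴿ (k ℕ.* n)     ≈⟨ *-cong (reflexive (P.cong (conj ζ ^ᴿ_) (ℕ.*-distribʳ-+ n m k))) refl ⟩
        conj ζ ^ᴿ (m ℕ.* n ℕ.+ k ℕ.* n) * ζ ^ᴿ (k ℕ.* n) ≈⟨ ^-+-cancelʳ (trans (*-comm (conj ζ) ζ) unitary) (m ℕ.* n) (k ℕ.* n) ⟩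
        conj ζ ^ᴿ (m ℕ.* n)                               ≈⟨ conj-^ ζ (m ℕ.* n) ⟨
        conj (ζ ^ᴿ (m ℕ.* n))                             ∎

    -- The field orthogonal only covers positive frequencies; for k < l the summand is the
    -- conjugate of one (conj is not assumed involutive, so the two cases are not symmetric).
    orthogonality : ∀ {k l} → 1 ℕ.≤ k → k ℕ.≤ N → 1 ℕ.≤ l → l ℕ.≤ N →
      Σ[ range1 N ] (λ n → ζ ^ᴿ (k ℕ.* n) * conj ζ ^ᴿ (l ℕ.* n)) ≈ ⟦ does (k ≟ l) ⟧ * ι N
    orthogonality {k} {l} 1≤k k≤N 1≤l l≤N with ℕ.<-cmp k l
    ... | tri≈ _ P.refl _ = begin
      Σ[ range1 N ] (e k k)       ≈⟨ Σ-cong (range1 N) (λ n → ^-*-inverse unitary (k ℕ.* n)) ⟩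
      Σ[ range1 N ] (λ _ → 1#)    ≈⟨ Σ-1 (range1 N) ⟩
      ι (length (range1 N))       ≡⟨ P.cong ι (length-range1 N) ⟩
      ι N                         ≈⟨ *-identityˡ (ι N) ⟨
      1# * ι N                    ≈⟨ *-cong (⟦≟⟧-refl k) refl ⟨
      ⟦ does (k ≟ k) ⟧ * ι N      ∎
    ... | tri< k<l k≢l _ = begin
      Σ[ range1 N ] (e k l)                                ≡⟨ P.cong (λ l → Σ[ range1 N ] (e k l)) (ℕ.m∸n+n≡m (ℕ.<⇒≤ k<l)) ⟨
      Σ[ range1 N ] (e k (l ℕ.∸ k ℕ.+ k))                  ≈⟨ Σ-cong (range1 N) (e-+ʳ (l ℕ.∸ k) k) ⟩
      Σ[ range1 N ] (λ n → conj (ζ ^ᴿ ((l ℕ.∸ k) ℕ.* n)))  ≈⟨ conj-Σ (range1 N) ⟨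
      conj (Σ[ range1 N ] (λ n → ζ ^ᴿ ((l ℕ.∸ k) ℕ.* n)))  ≈⟨ conj-cong (orthogonal (l ℕ.∸ k) (ℕ.m<n⇒0<n∸m k<l) (ℕ.<-≤-trans (ℕ.∸-monoʳ-< 1≤k (ℕ.<⇒≤ k<l)) l≤N)) ⟩
      conj 0#                                              ≈⟨ conj-0 ⟩
      0#                                                   ≈⟨ zeroˡ (ι N) ⟨
      0# * ι N                                             ≈⟨ *-cong (⟦≟⟧-≢ k≢l) refl ⟨
      ⟦ does (k ≟ l) ⟧ * ι N                               ∎
    ... | tri> _ k≢l l<k = begin
      Σ[ range1 N ] (e k l)                        ≡⟨ P.cong (λ k → Σ[ range1 N ] (e k l)) (ℕ.m∸n+n≡m (ℕ.<⇒≤ l<k)) ⟨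
      Σ[ range1 N ] (e (k ℕ.∸ l ℕ.+ l) l)          ≈⟨ Σ-cong (range1 N) (e-+ˡ (k ℕ.∸ l) l) ⟩
      Σ[ range1 N ] (λ n → ζ ^ᴿ ((k ℕ.∸ l) ℕ.* n)) ≈⟨ orthogonal (k ℕ.∸ l) (ℕ.m<n⇒0<n∸m l<k) (ℕ.<-≤-trans (ℕ.∸-monoʳ-< 1≤l (ℕ.<⇒≤ l<k)) k≤N) ⟩
      0#                                           ≈⟨ zeroˡ (ι N) ⟨
      0# * ι N                                     ≈⟨ *-cong (⟦≟⟧-≢ k≢l) refl ⟨
      ⟦ does (k ≟ l) ⟧ * ι N                       ∎

    parseval : ∀ f → Σ[ range1 N ] (λ n → ∣ dft N ζ f n ∣²) ≈ N ×ᴿ (Σ[ range1 N ] (λ k → ∣ f k ∣²))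
    parseval f = begin
      Σ[ xs ] (λ n → ∣ dft N ζ f n ∣²)
        ≈⟨ Σ-cong xs ∣dft∣²-expand ⟩
      Σ[ xs ] (λ n → Σ[ xs ] (λ k → Σ[ xs ] (λ l → c k l * e k l n)))
        ≈⟨ Σ-swap xs xs ⟩
      Σ[ xs ] (λ k → Σ[ xs ] (λ n → Σ[ xs ] (λ l → c k l * e k l n)))
        ≈⟨ Σ-cong xs (λ k → Σ-swap xs xs) ⟩
      Σ[ xs ] (λ k → Σ[ xs ] (λ l → Σ[ xs ] (λ n → c k l * e k l n)))
        ≈⟨ Σ-congᴬ (All-range1 N diagonal) ⟩
      Σ[ xs ] (λ k → ∣ f k ∣² * ι N)
        ≈⟨ Σ-*ʳ xs (ι N) ⟨
      Σ[ xs ] (λ k → ∣ f k ∣²) * ι N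
        ≈⟨ ×ᴿ≈*ι N _ ⟨
      N ×ᴿ (Σ[ xs ] (λ k → ∣ f k ∣²)) ∎
      where
      xs : List ℕ
      xs = range1 N
      c : ℕ → ℕ → Carrier
      c k l = f k * conj (f l)

      ∣dft∣²-expand : ∀ n → ∣ dft N ζ f n ∣² ≈ Σ[ xs ] (λ k → Σ[ xs ] (λ l → c k l * e k l n))
      ∣dft∣²-expand n = begin
        dft N ζ f n * conj (dft N ζ f n)
          ≈⟨ *-cong refl (trans (conj-Σ xs) (Σ-cong xs λ l → trans (conj-* _ _) (*-cong refl (conj-^ ζ (l ℕ.* n))))) ⟩
        dft N ζ f n * Σ[ xs ] (λ l → conj (f l) * conj ζ ^ᴿ (l ℕ.* n))
          ≈⟨ Σ-*ʳ xs _ ⟩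
        Σ[ xs ] (λ k → (f k * ζ ^ᴿ (k ℕ.* n)) * Σ[ xs ] (λ l → conj (f l) * conj ζ ^ᴿ (l ℕ.* n)))
          ≈⟨ Σ-cong xs (λ k → Σ-*ˡ xs _) ⟩
        Σ[ xs ] (λ k → Σ[ xs ] (λ l → (f k * ζ ^ᴿ (k ℕ.* n)) * (conj (f l) * conj ζ ^ᴿ (l ℕ.* n))))
          ≈⟨ Σ-cong xs (λ k → Σ-cong xs (λ l → *-Properties.interchange _ _ _ _)) ⟩
        Σ[ xs ] (λ k → Σ[ xs ] (λ l → c k l * e k l n)) ∎

      diagonal : ∀ {k} → 1 ℕ.≤ k → k ℕ.≤ N → Σ[ xs ] (λ l → Σ[ xs ] (λ n → c k l * e k l n)) ≈ ∣ f k ∣² * ι N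
      diagonal {k} 1≤k k≤N = begin
        Σ[ xs ] (λ l → Σ[ xs ] (λ n → c k l * e k l n))
          ≈⟨ Σ-cong xs (λ l → Σ-*ˡ xs (c k l)) ⟨
        Σ[ xs ] (λ l → c k l * Σ[ xs ] (e k l))
          ≈⟨ Σ-congᴬ (All-range1 N λ 1≤l l≤N → *-cong refl (orthogonality 1≤k k≤N 1≤l l≤N)) ⟩
        Σ[ xs ] (λ l → c k l * (⟦ does (k ≟ l) ⟧ * ι N))
          ≈⟨ Σ-cong xs (λ l → *-Properties.x∙yz≈y∙xz (c k l) _ (ι N)) ⟩
        Σ[ xs ] (λ l → ⟦ does (k ≟ l) ⟧ * (c k l * ι N))
          ≈⟨ Σ-δ (range1-unique N) (∈-range1⁺ 1≤k k≤N) (λ l → c k l * ι N) ⟩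
        c k k * ι N ∎

  ∣∣²-cong : ∀ {x y} → x ≈ y → ∣ x ∣² ≈ ∣ y ∣²
  ∣∣²-cong x≈y = *-cong x≈y (conj-cong x≈y)

  Σ∣∣²-even : ∀ r s .{{_ : NonZero r}} .{{_ : NonZero s}} {f} → IsEven r s f →
    Σ[ range1 (r ^ s) ] (λ k → ∣ f k ∣²) ≈ Σ[ divisors r ] (λ d → ∣ f (d ^ s) ∣² * ι (Jₛ s (quot (r ^ s) (d ^ s))))
  Σ∣∣²-even r s {f} f-even = begin
    Σ[ range1 (r ^ s) ] (λ k → ∣ f k ∣²)
      ≈⟨ Σ-congᴬ (All-range1 (r ^ s) λ 1≤k _ → ∣∣²-cong (f-even _ 1≤k)) ⟩
    Σ[ range1 (r ^ s) ] (λ k → ∣ f (gcdₛ s k (r ^ s)) ∣²)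
      ≈⟨ Σ-by-value (λ k → gcdₛ s k (r ^ s)) (λ v → ∣ f v ∣²) (divisor-powers-unique s r) (range1 (r ^ s)) (All.tabulate λ _ → gcdₛ-^ʳ∈ s _ r) ⟩
    Σ[ map (_^ s) (divisors r) ] (λ v → ∣ f v ∣² * ι (count v))
      ≈⟨ Σ-map (_^ s) (divisors r) ⟩
    Σ[ divisors r ] (λ d → ∣ f (d ^ s) ∣² * ι (count (d ^ s)))
      ≈⟨ Σ-congᴬ (All.map (λ {d} d∣r → *-cong refl (reflexive (P.cong ι (count-gcdₛ≡-∣ s r d d∣r)))) (all-filter (_∣? r) (range1 r))) ⟩
    Σ[ divisors r ] (λ d → ∣ f (d ^ s) ∣² * ι (Jₛ s (quot (r ^ s) (d ^ s)))) ∎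
    where
    count : ℕ → ℕ
    count v = length (filter (λ k → gcdₛ s k (r ^ s) ≟ v) (range1 (r ^ s)))

open StarCommRing using (Carrier; _≈_; _*_; ∣_∣²; Σ[_]_; _×ᴿ_; ι; dft; IsEven; IsUnitaryPrimitiveRoot)

mainTheorem4 : (R : StarCommRing) (r s : ℕ) → 1 ≤ r → 1 ≤ s →
    (ζ : Carrier R) → IsUnitaryPrimitiveRoot R (r ^ s) ζ →
    (f : ℕ → Carrier R) → IsEven R r s f →
    _≈_ R (Σ[_]_ R (range1 (r ^ s)) (λ n → ∣_∣² R (dft R (r ^ s) ζ f n)))
          (_×ᴿ_ R (r ^ s) (Σ[_]_ R (divisors r)
             (λ d → _*_ R (∣_∣² R (f (d ^ s))) (ι R (Jₛ s (quot (r ^ s) (d ^ s)))))))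
mainTheorem4 R r s 1≤r 1≤s ζ ζ-root f f-even =
  trans (parseval ζ-root f) (×ᴿ-congˡ (r ^ s) (Σ∣∣²-even r s f-even))
  where
  open StarCommRing R using (trans)
  open StarCommRingProperties R using (parseval; ×ᴿ-congˡ; Σ∣∣²-even)
  instance
    r≢0 : NonZero r
    r≢0 = >-nonZero 1≤r
    s≢0 : NonZero s
    s≢0 = >-nonZero 1≤s
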